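{- Let $G$ be a graph in which there is a unique set $S\subseteq V(G)$ such that $G[S]$ is isomorphic to $2K_2$. If every edge of $G$ is $2K_2$-critical for $S$, then $G$ is critically $2K_2$-exist.
   Context: All graphs are finite and simple; $2K_2$ denotes two disjoint edges. For an edge $uv$, $G/uv$ is obtained by deleting $u,v$ and adding a new vertex $w$ adjacent to every vertex of $(N(u)\cup N(v))\setminus\{u,v\}$. Define $f(S)=S$ if $u,v\notin S$ and $f(S)=(S\cup\{w\})\setminus\{u,v\}$ otherwise. For $S$ with $G[S]\cong H$, the edge $uv$ is $H$-critical for $S$ if $(G/uv)[f(S)]$ is not isomorphic to $H$. $G$ is critically $2K_2$-exist if $G$ has an induced $2K_2$ but $G/e$ has none for every $e\in E(G)$. -}

module Defs where

open import Data.Bool using (Bool; true; false; _∨_)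
open import Data.Fin using (Fin; zero; suc)
open import Data.Nat using (ℕ)
open import Data.Maybe using (Maybe; just; nothing)
open import Data.Product using (Σ; ∃; _×_; _,_)
open import Relation.Binary.PropositionalEquality using (_≡_; _≢_; refl)
open import Relation.Nullary using (¬_)
open import Function.Bundles using (_↔_; _⇔_)
open import Function.Definitions using (Injective)

record Graph (V : Set) : Set where
  field
    adj    : V → V → Bool
    sym    : ∀ x y → adj x y ≡ adj y x
    irrefl : ∀ x → adj x x ≡ false
open Graph public

Finite : Set → Set
Finite V = Σ ℕ λ n → V ↔ Fin n

Subset : Set → Set
Subset V = V → Bool

adj2K2 : Fin 4 → Fin 4 → Bool
adj2K2 zero (suc zero) = true
adj2K2 (suc zero) zero = true
adj2K2 (suc (suc zero)) (suc (suc (suc zero))) = true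
adj2K2 (suc (suc (suc zero))) (suc (suc zero)) = true
adj2K2 _ _ = false

Induced2K2 : {V : Set} → Graph V → Subset V → Set
Induced2K2 {V} G S =
  Σ (Fin 4 → V) λ φ →
    Injective _≡_ _≡_ φ
    × (∀ x → (S x ≡ true) ⇔ (∃ λ i → φ i ≡ x))
    × (∀ i j → adj G (φ i) (φ j) ≡ adj2K2 i j)

Has2K2 : {V : Set} → Graph V → Set
Has2K2 {V} G = ∃ λ (S : Subset V) → Induced2K2 G S

-- Vertex set of G/uv: the old vertices other than u, v, plus a new vertex
-- w (represented by nothing).
ContrV : (V : Set) → V → V → Set
ContrV V u v = Maybe (Σ V λ x → (x ≢ u) × (x ≢ v))

contrAdj : {V : Set} → Graph V → (u v : V) → ContrV V u v → ContrV V u v → Bool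
contrAdj G u v (just (x , _)) (just (y , _)) = adj G x y
contrAdj G u v nothing (just (y , _)) = adj G u y ∨ adj G v y
contrAdj G u v (just (x , _)) nothing = adj G u x ∨ adj G v x
contrAdj G u v nothing nothing = false

private
  ∨-sym-lemma : ∀ a b c d → a ≡ c → b ≡ d → (a ∨ b) ≡ (c ∨ d)
  ∨-sym-lemma a b .a .b refl refl = refl

contrSym : {V : Set} (G : Graph V) (u v : V) → ∀ x y → contrAdj G u v x y ≡ contrAdj G u v y x
contrSym G u v (just (x , _)) (just (y , _)) = sym G x y
contrSym G u v nothing (just _) = refl
contrSym G u v (just _) nothing = refl
contrSym G u v nothing nothing = refl

contrIrrefl : {V : Set} (G : Graph V) (u v : V) → ∀ x → contrAdj G u v x x ≡ false
contrIrrefl G u v (just (x , _)) = irrefl G x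
contrIrrefl G u v nothing = refl

contract : {V : Set} → Graph V → (u v : V) → Graph (ContrV V u v)
contract G u v = record
  { adj = contrAdj G u v ; sym = contrSym G u v ; irrefl = contrIrrefl G u v }

-- The map f from subsets of V(G) to subsets of V(G/uv):
-- f(S) = S if u,v ∉ S, and (S ∪ {w}) \ {u,v} otherwise.
fS : {V : Set} (u v : V) → Subset V → Subset (ContrV V u v)
fS u v S (just (x , _)) = S x
fS u v S nothing = S u ∨ S v

Critical : {V : Set} (G : Graph V) (u v : V) (S : Subset V) → Set
Critical G u v S = ¬ Induced2K2 (contract G u v) (fS u v S)

Critically2K2Exist : {V : Set} → Graph V → Set
Critically2K2Exist G =
  Has2K2 G × (∀ u v → adj G u v ≡ true → ¬ Has2K2 (contract G u v))

-- If G/uv contained an induced 2K2 ψ, it lifts to an induced 2K2 of G: an old vertex stays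
-- itself, and the contracted vertex w is replaced by whichever of u, v is adjacent to the
-- partner of w in ψ (the other two vertices of ψ are adjacent to neither u nor v). By
-- uniqueness the lift spans S, and contracting uv maps it back onto ψ; so ψ spans f(S),
-- contradicting the criticality of uv for S.
module Submission where

open import Defs hiding (sym)
open import Data.Bool using (true; false; _∨_; if_then_else_)
open import Data.Bool.Properties using (∨-zeroʳ)
open import Data.Empty using (⊥-elim)
open import Data.Fin using (Fin; zero; suc)
import Data.Fin.Properties as Fin
open import Data.Maybe using (just; nothing)
open import Data.Product using (∃; _,_)
open import Data.Sum using (_⊎_; inj₁; inj₂)
open import Function.Bundles using (_⇔_; mk⇔; Equivalence)
open import Function.Definitions using (Injective)
open import Function.Properties.Inverse using (↔⇒↣)
open import Relation.Binary.Definitions using (DecidableEquality)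
open import Relation.Binary.PropositionalEquality
  using (_≡_; _≢_; refl; sym; trans; cong; cong₂; subst)
open import Relation.Nullary using (Dec; yes; no; does)
open import Relation.Nullary.Decidable using (via-injection)

finite⇒decEq : {V : Set} → Finite V → DecidableEquality V
finite⇒decEq (_ , V↔Fin) = via-injection (↔⇒↣ V↔Fin) Fin._≟_

does≡true⇔ : {A : Set} (a? : Dec A) → does a? ≡ true ⇔ A
does≡true⇔ (yes a) = mk⇔ (λ _ → a) (λ _ → refl)
does≡true⇔ (no ¬a) = mk⇔ (λ ()) (λ a → ⊥-elim (¬a a))

partner : Fin 4 → Fin 4
partner zero                   = suc zero
partner (suc zero)             = zero
partner (suc (suc zero))       = suc (suc (suc zero))
partner (suc (suc (suc zero))) = suc (suc zero)

adj2K2-nonpartner : ∀ i j → j ≢ partner i → adj2K2 i j ≡ false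
adj2K2-nonpartner zero                   zero                   _  = refl
adj2K2-nonpartner zero                   (suc zero)             ne = ⊥-elim (ne refl)
adj2K2-nonpartner zero                   (suc (suc zero))       _  = refl
adj2K2-nonpartner zero                   (suc (suc (suc zero))) _  = refl
adj2K2-nonpartner (suc zero)             zero                   ne = ⊥-elim (ne refl)
adj2K2-nonpartner (suc zero)             (suc zero)             _  = refl
adj2K2-nonpartner (suc zero)             (suc (suc zero))       _  = refl
adj2K2-nonpartner (suc zero)             (suc (suc (suc zero))) _  = refl
adj2K2-nonpartner (suc (suc zero))       zero                   _  = refl
adj2K2-nonpartner (suc (suc zero))       (suc zero)             _  = refl
adj2K2-nonpartner (suc (suc zero))       (suc (suc zero))       _  = refl
adj2K2-nonpartner (suc (suc zero))       (suc (suc (suc zero))) ne = ⊥-elim (ne refl)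
adj2K2-nonpartner (suc (suc (suc zero))) zero                   _  = refl
adj2K2-nonpartner (suc (suc (suc zero))) (suc zero)             _  = refl
adj2K2-nonpartner (suc (suc (suc zero))) (suc (suc zero))       ne = ⊥-elim (ne refl)
adj2K2-nonpartner (suc (suc (suc zero))) (suc (suc (suc zero))) _  = refl

module Collapse {V : Set} (_≟_ : DecidableEquality V) (u v : V) where

  collapse : V → ContrV V u v
  collapse x with x ≟ u | x ≟ v
  ... | no x≢u | no x≢v = just (x , x≢u , x≢v)
  ... | _      | _      = nothing

  -- Proofs of x ≢ u are definitionally equal (⊥ is proof-irrelevant), so any witnesses do.
  collapse-old : ∀ {x} (x≢u : x ≢ u) (x≢v : x ≢ v) → collapse x ≡ just (x , x≢u , x≢v)
  collapse-old {x} x≢u x≢v with x ≟ u | x ≟ v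
  ... | yes x≡u | _       = ⊥-elim (x≢u x≡u)
  ... | no _    | yes x≡v = ⊥-elim (x≢v x≡v)
  ... | no _    | no _    = refl

  collapse-endpoint : ∀ {x} → (x ≡ u) ⊎ (x ≡ v) → collapse x ≡ nothing
  collapse-endpoint {x} x∈uv with x ≟ u | x ≟ v | x∈uv
  ... | yes _  | _      | _        = refl
  ... | no _   | yes _  | _        = refl
  ... | no x≢u | no _   | inj₁ x≡u = ⊥-elim (x≢u x≡u)
  ... | no _   | no x≢v | inj₂ x≡v = ⊥-elim (x≢v x≡v)

  collapse≡nothing : ∀ {x} → collapse x ≡ nothing → (x ≡ u) ⊎ (x ≡ v)
  collapse≡nothing {x} eq with x ≟ u | x ≟ v
  collapse≡nothing eq | yes x≡u | _       = inj₁ x≡u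
  collapse≡nothing eq | no _    | yes x≡v = inj₂ x≡v
  collapse≡nothing () | no _    | no _

  collapse≡just : ∀ {x y} {y≢u : y ≢ u} {y≢v : y ≢ v} →
    collapse x ≡ just (y , y≢u , y≢v) → x ≡ y
  collapse≡just {x} eq with x ≟ u | x ≟ v
  collapse≡just refl | no _ | no _ = refl

  fS-image : ∀ {n} (S : Subset V) (φ : Fin n → V) →
    (∀ x → S x ≡ true ⇔ ∃ λ i → φ i ≡ x) →
    ∀ y → fS u v S y ≡ true ⇔ ∃ λ i → collapse (φ i) ≡ y
  fS-image S φ S≡im (just (y , y≢u , y≢v)) = mk⇔
    (λ Sy → let i , φi≡y = to (S≡im y) Sy in
      i , trans (cong collapse φi≡y) (collapse-old y≢u y≢v))
    (λ (i , eq) → from (S≡im y) (i , collapse≡just eq))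
    where open Equivalence
  fS-image S φ S≡im nothing = mk⇔ to′ from′
    where
    open Equivalence
    hit : ∀ {x} → (x ≡ u) ⊎ (x ≡ v) → S x ≡ true → ∃ λ i → collapse (φ i) ≡ nothing
    hit x∈uv Sx = let i , φi≡x = to (S≡im _) Sx in
      i , trans (cong collapse φi≡x) (collapse-endpoint x∈uv)

    to′ : S u ∨ S v ≡ true → ∃ λ i → collapse (φ i) ≡ nothing
    to′ Su∨Sv with S u in Su
    ... | true  = hit (inj₁ refl) Su
    ... | false = hit (inj₂ refl) Su∨Sv

    from′ : (∃ λ i → collapse (φ i) ≡ nothing) → S u ∨ S v ≡ true
    from′ (i , eq) with collapse≡nothing eq
    ... | inj₁ φi≡u = cong (_∨ S v) (from (S≡im u) (i , φi≡u))
    ... | inj₂ φi≡v = trans (cong (S u ∨_) (from (S≡im v) (i , φi≡v))) (∨-zeroʳ (S u))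

module Lift {V : Set} (_≟_ : DecidableEquality V) (G : Graph V) (u v : V) where

  open Collapse _≟_ u v

  -- The clause for nothing is a default: in a lift, w is never its own partner.
  endpointFacing : ContrV V u v → V
  endpointFacing (just (y , _)) = if adj G u y then u else v
  endpointFacing nothing        = u

  endpointFacing-endpoint : ∀ c → (endpointFacing c ≡ u) ⊎ (endpointFacing c ≡ v)
  endpointFacing-endpoint (just (y , _)) with adj G u y
  ... | true  = inj₁ refl
  ... | false = inj₂ refl
  endpointFacing-endpoint nothing = inj₁ refl

  adj-endpointFacing : ∀ y (y≢u : y ≢ u) (y≢v : y ≢ v) →
    adj G (endpointFacing (just (y , y≢u , y≢v))) y ≡ adj G u y ∨ adj G v y
  adj-endpointFacing y _ _ with adj G u y in u~y
  ... | true  = u~y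
  ... | false = refl

  adj-endpointFacing-unseen : ∀ c y → adj G u y ∨ adj G v y ≡ false →
    adj G (endpointFacing c) y ≡ false
  adj-endpointFacing-unseen c y unseen with endpointFacing-endpoint c | adj G u y in u≁y
  adj-endpointFacing-unseen c y unseen | inj₁ e | false = trans (cong (λ x → adj G x y) e) u≁y
  adj-endpointFacing-unseen c y unseen | inj₂ e | false = trans (cong (λ x → adj G x y) e) unseen
  adj-endpointFacing-unseen c y ()     | _      | true

  liftVertex : ContrV V u v → ContrV V u v → V
  liftVertex (just (x , _)) _ = x
  liftVertex nothing        c = endpointFacing c

  collapse-liftVertex : ∀ a c → collapse (liftVertex a c) ≡ a
  collapse-liftVertex (just (_ , x≢u , x≢v)) _ = collapse-old x≢u x≢v
  collapse-liftVertex nothing                c = collapse-endpoint (endpointFacing-endpoint c)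

  module _ (ψ : Fin 4 → ContrV V u v) (ψ-injective : Injective _≡_ _≡_ ψ)
           (ψ-adj : ∀ i j → contrAdj G u v (ψ i) (ψ j) ≡ adj2K2 i j) where

    lift : Fin 4 → V
    lift i = liftVertex (ψ i) (ψ (partner i))

    collapse-lift : ∀ i → collapse (lift i) ≡ ψ i
    collapse-lift i = collapse-liftVertex (ψ i) (ψ (partner i))

    lift-injective : Injective _≡_ _≡_ lift
    lift-injective {i} {j} eq =
      ψ-injective (trans (sym (collapse-lift i)) (trans (cong collapse eq) (collapse-lift j)))

    -- Within ψ, the contracted vertex w sees only its partner; so do both u and v.
    adj-lift-contracted : ∀ i j {y y≢u y≢v} → ψ i ≡ nothing → ψ j ≡ just (y , y≢u , y≢v) →
      adj G (endpointFacing (ψ (partner i))) y ≡ adj G u y ∨ adj G v y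
    adj-lift-contracted i j {y} {y≢u} {y≢v} ψi≡w ψj≡y with j Fin.≟ partner i
    ... | yes refl rewrite ψj≡y = adj-endpointFacing y y≢u y≢v
    ... | no j≢i′ = trans (adj-endpointFacing-unseen (ψ (partner i)) y unseen) (sym unseen)
      where
      unseen : adj G u y ∨ adj G v y ≡ false
      unseen = trans (cong₂ (contrAdj G u v) (sym ψi≡w) (sym ψj≡y))
                     (trans (ψ-adj i j) (adj2K2-nonpartner i j j≢i′))

    adj-lift : ∀ i j → adj G (lift i) (lift j) ≡ contrAdj G u v (ψ i) (ψ j)
    adj-lift i j with ψ i in ψi | ψ j in ψj
    ... | just _       | just _       = refl
    ... | nothing      | just _       = adj-lift-contracted i j ψi ψj
    ... | just (x , _) | nothing      = trans (Graph.sym G x _) (adj-lift-contracted j i ψj ψi)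
    ... | nothing      | nothing with ψ-injective (trans ψi (sym ψj))
    ...   | refl = irrefl G _

    image : Subset V
    image x = does (Fin.any? λ i → lift i ≟ x)

    image-spec : ∀ x → image x ≡ true ⇔ ∃ λ i → lift i ≡ x
    image-spec x = does≡true⇔ (Fin.any? λ i → lift i ≟ x)

    lift-induced : Induced2K2 G image
    lift-induced = lift , lift-injective , image-spec ,
                   λ i j → trans (adj-lift i j) (ψ-adj i j)

    collapse-induced : ∀ S → (∀ x → image x ≡ S x) → Induced2K2 (contract G u v) (fS u v S)
    collapse-induced S image≡S = ψ , ψ-injective , S↦ψ , ψ-adj
      where
      open Equivalence
      S≡image : ∀ x → S x ≡ true ⇔ ∃ λ i → lift i ≡ x
      S≡image x = subst (λ b → b ≡ true ⇔ _) (image≡S x) (image-spec x)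

      S↦ψ : ∀ y → fS u v S y ≡ true ⇔ ∃ λ i → ψ i ≡ y
      S↦ψ y = mk⇔
        (λ fSy → let i , eq = to (fS-image S lift S≡image y) fSy in
          i , trans (sym (collapse-lift i)) eq)
        (λ (i , eq) → from (fS-image S lift S≡image y) (i , trans (collapse-lift i) eq))

lemma21 : {V : Set} → Finite V → (G : Graph V) → (S : Subset V) →
    Induced2K2 G S →
    (∀ (S′ : Subset V) → Induced2K2 G S′ → ∀ x → S′ x ≡ S x) →
    (∀ u v → adj G u v ≡ true → Critical G u v S) →
    Critically2K2Exist G
lemma21 fin G S G[S]≅2K2 unique critical =
  (S , G[S]≅2K2) , λ u v uv∈E (_ , ψ , ψ-injective , _ , ψ-adj) →
    let open Lift (finite⇒decEq fin) G u v in
    critical u v uv∈E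
      (collapse-induced ψ ψ-injective ψ-adj S (unique _ (lift-induced ψ ψ-injective ψ-adj)))
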